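{- Let $q$ be a prime power. For $l\in\{1,2\}$ let $\mathcal F_l\subseteq[m_l]\times[n_l]$ be an $m_l\times n_l$ Ferrers diagram and $\mathbf M_l\in\mathbb F_q^{m_l\times n_l}$ a matrix whose entries at positions not in $\mathcal F_l$ are all zero. Let $\mathcal F$ be an $m\times n$ Ferrers diagram which is a proper combination of $\mathcal F_1$ and $\mathcal F_2$ on injections $\phi_1,\phi_2$. Define $\mathbf M_{12}\in\mathbb F_q^{m\times n}$ by $\mathbf M_{12}(i,j)=\mathbf M_1(i_1,j_1)$ if $(i,j)=\phi_1(i_1,j_1)$ with $(i_1,j_1)\in\mathcal F_1$; $\mathbf M_{12}(i,j)=\mathbf M_2(i_2,j_2)$ if $(i,j)=\phi_2(i_2,j_2)$ with $(i_2,j_2)\in\mathcal F_2$; and $\mathbf M_{12}(i,j)=0$ otherwise. Then $\mathrm{rank}(\mathbf M_{12})\leq\mathrm{rank}(\mathbf M_1)+\mathrm{rank}(\mathbf M_2)$.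
   Context: $[a]$ denotes $\{0,1,\dots,a-1\}$. An $m\times n$ Ferrers diagram is a set $\mathcal F\subseteq[m]\times[n]$ of cells ("dots") such that: if $(i,j)\in\mathcal F$, $i\ge1$ then $(i-1,j)\in\mathcal F$; if $(i,j)\in\mathcal F$, $j\le n-2$ then $(i,j+1)\in\mathcal F$; row $0$ has $n$ dots and column $n-1$ has $m$ dots. $\mathcal F$ is a proper combination of $\mathcal F_1$ and $\mathcal F_2$ on injections $\phi_l:\mathcal F_l\to\mathcal F$ ($l=1,2$) if $\phi_1(\mathcal F_1)\cap\phi_2(\mathcal F_2)=\varnothing$, $|\mathcal F_1|+|\mathcal F_2|=|\mathcal F|$, and for each $l$ and any two distinct cells $(i_1,j_1),(i_2,j_2)\in\mathcal F_l$ with $i_1=i_2$ or $j_1=j_2$, the images $\phi_l(i_1,j_1)=(i_1',j_1')$, $\phi_l(i_2,j_2)=(i_2',j_2')$ satisfy $i_1'=i_2'$ or $j_1'=j_2'$. -}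

module Defs where

open import Level using (Level; _⊔_)
open import Data.Nat using (ℕ; zero; suc; _+_; _^_; _≤_)
open import Data.Nat.Primality using (Prime)
open import Data.Fin using (Fin; toℕ)
import Data.Fin as Fin
import Data.Product
open import Data.Bool using (Bool; true; false; if_then_else_)
open import Data.List using (List; map; allFin)
open import Data.Nat.ListAction using (sum)
open import Data.Product using (_×_; _,_; ∃; ∃-syntax; Σ-syntax)
open import Data.Sum using (_⊎_)
open import Relation.Nullary using (¬_)
open import Relation.Binary.PropositionalEquality using (_≡_; _≢_)
open import Algebra.Bundles using (CommutativeRing)

IsPrimePower : ℕ → Set
IsPrimePower q = ∃[ p ] ∃[ k ] (Prime p × 1 ≤ k × q ≡ p ^ k)

record Field (c ℓ : Level) : Set (Level.suc (c ⊔ ℓ)) where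
  field
    commRing : CommutativeRing c ℓ
  open CommutativeRing commRing public
  field
    0≉1     : ¬ (0# ≈ 1#)
    inverse : ∀ x → ¬ (x ≈ 0#) → ∃[ y ] (x * y ≈ 1#)

HasCardinality : ∀ {c ℓ} → Field c ℓ → ℕ → Set (c ⊔ ℓ)
HasCardinality K q =
  Σ[ e ∈ (Fin q → Carrier) ]
    ((∀ i j → e i ≈ e j → i ≡ j) × (∀ x → ∃[ i ] (e i ≈ x)))
  where open Field K

module LinAlg {c ℓ} (K : Field c ℓ) where
  open Field K hiding (_+_)
  open Field K using () renaming (_+_ to _⊕_)

  Matrix : ℕ → ℕ → Set c
  Matrix m n = Fin m → Fin n → Carrier

  Σ : ∀ {r} → (Fin r → Carrier) → Carrier
  Σ {zero}  f = 0#
  Σ {suc r} f = f Fin.zero ⊕ Σ (λ k → f (Fin.suc k))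

  IndependentCols : ∀ {m n r} → Matrix m n → (Fin r → Fin n) → Set (c ⊔ ℓ)
  IndependentCols {r = r} M σ =
    (a : Fin r → Carrier) →
    (∀ i → Σ (λ k → a k * M i (σ k)) ≈ 0#) →
    ∀ k → a k ≈ 0#

  IsRank : ∀ {m n} → Matrix m n → ℕ → Set (c ⊔ ℓ)
  IsRank {n = n} M r =
    (Σ[ σ ∈ (Fin r → Fin n) ] IndependentCols M σ) ×
    (∀ s (τ : Fin s → Fin n) → IndependentCols M τ → s ≤ r)

Diagram : ℕ → ℕ → Set
Diagram m n = Fin m → Fin n → Bool

Cell : ℕ → ℕ → Set
Cell m n = Fin m × Fin n

_∈D_ : ∀ {m n} → Cell m n → Diagram m n → Set
(i , j) ∈D F = F i j ≡ true

record IsFerrers {m n} (F : Diagram m n) : Set where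
  field
    up    : ∀ i i' j → suc (toℕ i') ≡ toℕ i → (i , j) ∈D F → (i' , j) ∈D F
    right : ∀ i j j' → toℕ j' ≡ suc (toℕ j) → (i , j) ∈D F → (i , j') ∈D F
    row0  : ∀ i j → toℕ i ≡ 0 → (i , j) ∈D F
    colLast : ∀ i j → suc (toℕ j) ≡ n → (i , j) ∈D F

size : ∀ {m n} → Diagram m n → ℕ
size {m} {n} F =
  sum (map (λ i → sum (map (λ j → if F i j then 1 else 0) (allFin n))) (allFin m))

record ProperMap {m₁ n₁ m n} (F₁ : Diagram m₁ n₁) (F : Diagram m n)
                 (φ : Cell m₁ n₁ → Cell m n) : Set where
  field
    into      : ∀ x → x ∈D F₁ → φ x ∈D F
    injective : ∀ x y → x ∈D F₁ → y ∈D F₁ → φ x ≡ φ y → x ≡ y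
    lines     : ∀ i₁ j₁ i₂ j₂ → (i₁ , j₁) ∈D F₁ → (i₂ , j₂) ∈D F₁ →
                (i₁ , j₁) ≢ (i₂ , j₂) → (i₁ ≡ i₂ ⊎ j₁ ≡ j₂) →
                (Data.Product.proj₁ (φ (i₁ , j₁)) ≡ Data.Product.proj₁ (φ (i₂ , j₂))
                 ⊎ Data.Product.proj₂ (φ (i₁ , j₁)) ≡ Data.Product.proj₂ (φ (i₂ , j₂)))

record ProperCombination {m₁ n₁ m₂ n₂ m n}
         (F₁ : Diagram m₁ n₁) (F₂ : Diagram m₂ n₂) (F : Diagram m n)
         (φ₁ : Cell m₁ n₁ → Cell m n) (φ₂ : Cell m₂ n₂ → Cell m n) : Set where
  field
    map₁     : ProperMap F₁ F φ₁
    map₂     : ProperMap F₂ F φ₂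
    disjoint : ∀ x y → x ∈D F₁ → y ∈D F₂ → φ₁ x ≢ φ₂ y
    card     : size F₁ + size F₂ ≡ size F

-- Since φₗ sends cells of Fₗ on a common row or column to cells on a common
-- row or column, and the first row and last column of the Ferrers diagram Fₗ
-- are full, φₗ restricted to Fₗ either has the form (i , j) ↦ (ρ i , κ j) or
-- (i , j) ↦ (κ j , ρ i) with ρ, κ injective, or maps all of Fₗ into one row
-- or one column. So the extension by zero Pₗ of Mₗ along φₗ embeds Mₗ or its
-- transpose, or has a single nonzero row or column: in each case its columns
-- lie in the span of rank Mₗ vectors. The images of φ₁ and φ₂ are disjoint,
-- hence M₁₂ = P₁ + P₂ and its columns lie in the span of rank M₁ + rank M₂
-- vectors. Over a finite field a spanning set is at least as large as an
-- independent one by counting: the q ^ r combinations of r independent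
-- vectors are distinct, and those of s vectors number at most q ^ s.
module Submission where

open import Defs
open import Data.Bool using (true; false)
import Data.Bool.Properties as Bool
open import Data.Empty using (⊥-elim)
open import Data.Fin
  using (Fin; zero; suc; fromℕ; _↑ˡ_; _↑ʳ_; funToFin; finToFun; combine)
open import Data.Fin.Properties
  using (_≟_; any?; all?; ¬∀⟶∃¬; toℕ-fromℕ; injective⇒≤; funToFin-finToFin; finToFun-funToFin)
open import Data.Nat as ℕ using (ℕ; zero; suc; _≤_; _<_; _^_; s≤s; z≤n)
open import Data.Nat.Properties using (_≤?_; ≰⇒>; <⇒≱; ^-monoʳ-<; 1+n≰n)
open import Data.Product using (_×_; _,_; proj₁; proj₂; ∃; ∃-syntax; Σ-syntax; swap)
open import Data.Product.Properties using (≡-dec; ×-≡,≡→≡; ×-≡,≡←≡)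
open import Data.Sum as Sum using (_⊎_; inj₁; inj₂)
open import Data.Vec.Functional using (Vector; []; _∷_; tail; _++_; transpose)
open import Data.Vec.Functional.Properties using (lookup-++ˡ; lookup-++ʳ)
open import Function using (_∘_)
open import Function.Definitions using (Injective)
open import Level using (_⊔_)
open import Relation.Binary using (Decidable)
open import Relation.Binary.PropositionalEquality
  using (_≡_; _≢_; _≗_; refl; sym; trans; cong; cong₂; module ≡-Reasoning)
open import Relation.Nullary using (¬_; Dec; yes; no; contradiction)
open import Relation.Nullary.Decidable using (map′; _×-dec_)

Aligned : ∀ {a b} → Fin a × Fin b → Fin a × Fin b → Set
Aligned p p′ = proj₁ p ≡ proj₁ p′ ⊎ proj₂ p ≡ proj₂ p′

pairwiseAligned⇒aligned : ∀ {k a b} (p : Fin k → Fin a × Fin b) (t : Fin k) →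
  (∀ u v → Aligned (p u) (p v)) →
  (∀ u → proj₁ (p u) ≡ proj₁ (p t)) ⊎ (∀ u → proj₂ (p u) ≡ proj₂ (p t))
pairwiseAligned⇒aligned {k} p t aligned with all? (λ u → proj₁ (p u) ≟ proj₁ (p t))
... | yes sameRow = inj₁ sameRow
... | no ¬sameRow = inj₂ sameColumn
  where
  offRow : ∃ λ u₀ → proj₁ (p u₀) ≢ proj₁ (p t)
  offRow = ¬∀⟶∃¬ k _ (λ u → proj₁ (p u) ≟ proj₁ (p t)) ¬sameRow

  u₀ : Fin k
  u₀ = proj₁ offRow

  column-if-rows-differ : ∀ u v → proj₁ (p u) ≢ proj₁ (p v) → proj₂ (p u) ≡ proj₂ (p v)
  column-if-rows-differ u v rows≢ = Sum.fromInj₂ (λ rows≡ → contradiction rows≡ rows≢) (aligned u v)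

  sameColumn : ∀ u → proj₂ (p u) ≡ proj₂ (p t)
  sameColumn u with proj₁ (p u) ≟ proj₁ (p u₀)
  ... | no rows≢ = trans (column-if-rows-differ u u₀ rows≢) (column-if-rows-differ u₀ t (proj₂ offRow))
  ... | yes rows≡ = column-if-rows-differ u t (λ rows≡′ → proj₂ offRow (trans (sym rows≡) rows≡′))

module _ {m₁ n₁ m n : ℕ} where

  InjectiveOn : Diagram m₁ n₁ → (Cell m₁ n₁ → Cell m n) → Set
  InjectiveOn F ψ = ∀ x y → x ∈D F → y ∈D F → ψ x ≡ ψ y → x ≡ y

  PreservesLines : Diagram m₁ n₁ → (Cell m₁ n₁ → Cell m n) → Set
  PreservesLines F ψ = ∀ i₁ j₁ i₂ j₂ → (i₁ , j₁) ∈D F → (i₂ , j₂) ∈D F →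
    (i₁ , j₁) ≢ (i₂ , j₂) → i₁ ≡ i₂ ⊎ j₁ ≡ j₂ → Aligned (ψ (i₁ , j₁)) (ψ (i₂ , j₂))

  Preimage : Diagram m₁ n₁ → (Cell m₁ n₁ → Cell m n) → Fin m → Fin n → Set
  Preimage F ψ x y = ∃[ i ] ∃[ j ] ((i , j) ∈D F × ψ (i , j) ≡ (x , y))

  preimage? : ∀ F ψ x y → Dec (Preimage F ψ x y)
  preimage? F ψ x y =
    any? (λ i → any? (λ j → (F i j Bool.≟ true) ×-dec ≡-dec _≟_ _≟_ (ψ (i , j)) (x , y)))

  data Shape (F : Diagram m₁ n₁) (ψ : Cell m₁ n₁ → Cell m n) : Set where
    product    : (ρ : Fin m₁ → Fin m) (κ : Fin n₁ → Fin n) →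
                 Injective _≡_ _≡_ ρ → Injective _≡_ _≡_ κ →
                 (∀ i j → (i , j) ∈D F → ψ (i , j) ≡ (ρ i , κ j)) → Shape F ψ
    transposed : (ρ : Fin m₁ → Fin n) (κ : Fin n₁ → Fin m) →
                 Injective _≡_ _≡_ ρ → Injective _≡_ _≡_ κ →
                 (∀ i j → (i , j) ∈D F → ψ (i , j) ≡ (κ j , ρ i)) → Shape F ψ
    inRow      : (X : Fin m) → (∀ i j → (i , j) ∈D F → proj₁ (ψ (i , j)) ≡ X) → Shape F ψ
    inColumn   : (Y : Fin n) → (∀ i j → (i , j) ∈D F → proj₂ (ψ (i , j)) ≡ Y) → Shape F ψ

InjectiveOn-swap : ∀ {m₁ n₁ m n} {F : Diagram m₁ n₁} {ψ : Cell m₁ n₁ → Cell m n} →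
  InjectiveOn F ψ → InjectiveOn F (swap ∘ ψ)
InjectiveOn-swap injective x y x∈F y∈F same = injective x y x∈F y∈F (cong swap same)

PreservesLines-swap : ∀ {m₁ n₁ m n} {F : Diagram m₁ n₁} {ψ : Cell m₁ n₁ → Cell m n} →
  PreservesLines F ψ → PreservesLines F (swap ∘ ψ)
PreservesLines-swap lines i₁ j₁ i₂ j₂ c₁ c₂ distinct line =
  Sum.swap (lines i₁ j₁ i₂ j₂ c₁ c₂ distinct line)

module LineImages {m′ n′ m n} {F : Diagram (suc m′) (suc n′)}
                  {ψ : Cell (suc m′) (suc n′) → Cell m n} (ferrers : IsFerrers F)
                  (injective : InjectiveOn F ψ) (lines : PreservesLines F ψ) where

  L : Fin (suc n′)
  L = fromℕ n′

  X : Fin m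
  X = proj₁ (ψ (zero , L))

  Y : Fin n
  Y = proj₂ (ψ (zero , L))

  ρ : Fin (suc m′) → Fin m
  ρ i = proj₁ (ψ (i , L))

  κ : Fin (suc n′) → Fin n
  κ j = proj₂ (ψ (zero , j))

  first-row : ∀ j → (zero , j) ∈D F
  first-row j = IsFerrers.row0 ferrers zero j refl

  last-column : ∀ i → (i , L) ∈D F
  last-column i = IsFerrers.colLast ferrers i L (cong suc (toℕ-fromℕ n′))

  aligned : ∀ {i₁ j₁ i₂ j₂} → (i₁ , j₁) ∈D F → (i₂ , j₂) ∈D F → i₁ ≡ i₂ ⊎ j₁ ≡ j₂ →
    Aligned (ψ (i₁ , j₁)) (ψ (i₂ , j₂))
  aligned {i₁} {j₁} {i₂} {j₂} c₁ c₂ line with ≡-dec _≟_ _≟_ (i₁ , j₁) (i₂ , j₂)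
  ... | yes same = inj₁ (cong (proj₁ ∘ ψ) same)
  ... | no distinct = lines i₁ j₁ i₂ j₂ c₁ c₂ distinct line

  FirstRowToRow FirstRowToColumn LastColumnToRow LastColumnToColumn : Set
  FirstRowToRow = ∀ j → proj₁ (ψ (zero , j)) ≡ X
  FirstRowToColumn = ∀ j → proj₂ (ψ (zero , j)) ≡ Y
  LastColumnToRow = ∀ i → proj₁ (ψ (i , L)) ≡ X
  LastColumnToColumn = ∀ i → proj₂ (ψ (i , L)) ≡ Y

  first-row-image : FirstRowToRow ⊎ FirstRowToColumn
  first-row-image = pairwiseAligned⇒aligned (λ j → ψ (zero , j)) L
    (λ u v → aligned (first-row u) (first-row v) (inj₁ refl))

  last-column-image : LastColumnToRow ⊎ LastColumnToColumn
  last-column-image = pairwiseAligned⇒aligned (λ i → ψ (i , L)) zero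
    (λ u v → aligned (last-column u) (last-column v) (inj₂ refl))

  at-corner : ∀ {i j} → (i , j) ∈D F → proj₁ (ψ (i , j)) ≡ X → proj₂ (ψ (i , j)) ≡ Y →
    (i , j) ≡ (zero , L)
  at-corner c row col = injective _ _ c (first-row L) (×-≡,≡→≡ (row , col))

  ρ-injective : LastColumnToColumn → Injective _≡_ _≡_ ρ
  ρ-injective toColumn {i} {i′} same = cong proj₁ (injective _ _ (last-column i) (last-column i′)
    (×-≡,≡→≡ (same , trans (toColumn i) (sym (toColumn i′)))))

  κ-injective : FirstRowToRow → Injective _≡_ _≡_ κ
  κ-injective toRow {j} {j′} same = cong proj₂ (injective _ _ (first-row j) (first-row j′)
    (×-≡,≡→≡ (trans (toRow j) (sym (toRow j′)) , same)))

  -- An interior cell is aligned with (0 , j) and with (i , L); every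
  -- combination but "column of the first, row of the second" puts one of
  -- these three cells onto ψ (0 , L).
  product-form : FirstRowToRow → LastColumnToColumn →
    ∀ i j → (i , j) ∈D F → ψ (i , j) ≡ (ρ i , κ j)
  product-form toRow toColumn i j c with i ≟ zero | j ≟ L
  ... | yes refl | _ = ×-≡,≡→≡ (toRow j , refl)
  ... | no _ | yes refl = ×-≡,≡→≡ (refl , toColumn i)
  ... | no i≢0 | no j≢L with aligned c (first-row j) (inj₂ refl) | aligned c (last-column i) (inj₁ refl)
  ...   | inj₂ col | inj₁ row = ×-≡,≡→≡ (row , col)
  ...   | inj₁ row | inj₁ row′ = ⊥-elim (i≢0 (cong proj₁
          (at-corner (last-column i) (trans (sym row′) (trans row (toRow j))) (toColumn i))))
  ...   | inj₁ row | inj₂ col′ = ⊥-elim (i≢0 (cong proj₁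
          (at-corner c (trans row (toRow j)) (trans col′ (toColumn i)))))
  ...   | inj₂ col | inj₂ col′ = ⊥-elim (j≢L (cong proj₂
          (at-corner (first-row j) (toRow j) (trans (sym col) (trans col′ (toColumn i))))))

  row-form : FirstRowToRow → LastColumnToRow → ∀ i j → (i , j) ∈D F → proj₁ (ψ (i , j)) ≡ X
  row-form toRow toRow′ i j c
    with aligned c (first-row j) (inj₂ refl) | aligned c (last-column i) (inj₁ refl)
  ... | inj₁ row | _ = trans row (toRow j)
  ... | inj₂ _ | inj₁ row′ = trans row′ (toRow′ i)
  ... | inj₂ col | inj₂ col′ = trans (cong (λ i → proj₁ (ψ (i , j))) i≡0) (toRow j)
    where
    i≡0 : i ≡ zero
    i≡0 = cong proj₁ (injective _ _ (last-column i) (first-row j)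
      (×-≡,≡→≡ (trans (toRow′ i) (sym (toRow j)) , trans (sym col′) col)))

shape : ∀ {m′ n′ m n} {F : Diagram (suc m′) (suc n′)}
  {ψ : Cell (suc m′) (suc n′) → Cell m n} →
  IsFerrers F → InjectiveOn F ψ → PreservesLines F ψ → Shape F ψ
shape {F = F} {ψ} ferrers injective lines = classify first-row-image last-column-image
  where
  open LineImages ferrers injective lines
  module T = LineImages ferrers (InjectiveOn-swap injective) (PreservesLines-swap lines)

  classify : FirstRowToRow ⊎ FirstRowToColumn → LastColumnToRow ⊎ LastColumnToColumn →
    Shape F ψ
  classify (inj₁ toRow) (inj₂ toColumn) =
    product ρ κ (ρ-injective toColumn) (κ-injective toRow) (product-form toRow toColumn)
  classify (inj₂ toColumn) (inj₁ toRow) =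
    transposed T.ρ T.κ (T.ρ-injective toRow) (T.κ-injective toColumn)
      (λ i j c → cong swap (T.product-form toColumn toRow i j c))
  classify (inj₁ toRow) (inj₁ toRow′) = inRow X (row-form toRow toRow′)
  classify (inj₂ toColumn) (inj₂ toColumn′) = inColumn Y (T.row-form toColumn toColumn′)

≢⇒1< : ∀ {n} {i j : Fin n} → i ≢ j → 1 < n
≢⇒1< {suc zero} {zero} {zero} i≢j = contradiction refl i≢j
≢⇒1< {suc (suc _)} _ = s≤s (s≤s z≤n)

funToFin-cong : ∀ {r q} {f g : Fin r → Fin q} → f ≗ g → funToFin f ≡ funToFin g
funToFin-cong {zero} _ = refl
funToFin-cong {suc r} f≗g = cong₂ combine (f≗g zero) (funToFin-cong (f≗g ∘ suc))

power-injection⇒≤ : ∀ {q r s} → 1 < q → (G : (Fin r → Fin q) → Fin s → Fin q) →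
  (∀ f g → G f ≗ G g → f ≗ g) → r ≤ s
power-injection⇒≤ {q} {r} {s} 1<q G G-injective with r ≤? s
... | yes r≤s = r≤s
... | no r≰s =
  contradiction (injective⇒≤ encoded-injective) (<⇒≱ (^-monoʳ-< q 1<q (≰⇒> r≰s)))
  where
  encoded : Fin (q ^ r) → Fin (q ^ s)
  encoded = funToFin ∘ G ∘ finToFun

  encoded-injective : Injective _≡_ _≡_ encoded
  encoded-injective {i} {j} same = begin
    i                             ≡⟨ funToFin-finToFin {m = r} {n = q} i ⟨
    funToFin (finToFun {q} {r} i) ≡⟨ funToFin-cong (G-injective _ _ agree) ⟩
    funToFin (finToFun {q} {r} j) ≡⟨ funToFin-finToFin {m = r} {n = q} j ⟩
    j                             ∎
    where
    open ≡-Reasoning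
    agree : G (finToFun i) ≗ G (finToFun j)
    agree l = trans (sym (finToFun-funToFin (G (finToFun i)) l))
                (trans (cong (λ z → finToFun z l) same) (finToFun-funToFin (G (finToFun j)) l))

module LinearAlgebra {c ℓ} (K : Field c ℓ) where

  open Field K hiding (zero) renaming (refl to ≈-refl; sym to ≈-sym; trans to ≈-trans)
  open LinAlg K using (Matrix; Σ; IndependentCols)
  open import Algebra.Properties.Semiring.Sum semiring
    using ( sum; sum-cong-≋; sum-cong-≗; ∑-distrib-+; ∑-comm
          ; *-distribˡ-sum; *-distribʳ-sum; sum-replicate-zero)
  open import Algebra.Properties.Ring ring
    using ( -1*x≈-x; [y-z]x≈yx-zx; x≈y⇒x∙y⁻¹≈ε; x∙y⁻¹≈ε⇒x≈y
          ; +-inverseˡ-unique; -‿distribˡ-*; -‿distribʳ-*)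
  open import Relation.Binary.Reasoning.Setoid setoid

  column : ∀ {m n} → Matrix m n → Fin n → Vector Carrier m
  column M j i = M i j

  combination : ∀ {r m} → Vector Carrier r → (Fin r → Vector Carrier m) → Vector Carrier m
  combination a v x = sum (λ k → a k * v k x)

  LinearlyIndependent : ∀ {r m} → (Fin r → Vector Carrier m) → Set (c ⊔ ℓ)
  LinearlyIndependent v = ∀ a → (∀ x → combination a v x ≈ 0#) → ∀ k → a k ≈ 0#

  infix 4 _∈Span_
  _∈Span_ : ∀ {s m} → Vector Carrier m → (Fin s → Vector Carrier m) → Set (c ⊔ ℓ)
  u ∈Span w = ∃[ b ] ∀ x → u x ≈ combination b w x

  RankAtMost : ∀ {m n} → Matrix m n → ℕ → Set (c ⊔ ℓ)
  RankAtMost {m} M s = Σ[ w ∈ (Fin s → Vector Carrier m) ] ∀ j → column M j ∈Span w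

  Σ≡sum : ∀ {r} (f : Vector Carrier r) → Σ f ≡ sum f
  Σ≡sum {zero} f = refl
  Σ≡sum {suc r} f = cong (f zero +_) (Σ≡sum (f ∘ suc))

  independentCols⇒linearlyIndependent : ∀ {m n r} (M : Matrix m n) (σ : Fin r → Fin n) →
    IndependentCols M σ → LinearlyIndependent (column M ∘ σ)
  independentCols⇒linearlyIndependent M σ independent a vanishes =
    independent a (λ i → ≈-trans (reflexive (Σ≡sum (λ k → a k * M i (σ k)))) (vanishes i))

  linearlyIndependent⇒independentCols : ∀ {m n r} (M : Matrix m n) (σ : Fin r → Fin n) →
    LinearlyIndependent (column M ∘ σ) → IndependentCols M σ
  linearlyIndependent⇒independentCols M σ independent a vanishes =
    independent a (λ i → ≈-trans (reflexive (sym (Σ≡sum (λ k → a k * M i (σ k)))))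
                                  (vanishes i))

  sum-neg : ∀ {r} (f : Vector Carrier r) → sum (λ k → - f k) ≈ - sum f
  sum-neg f = begin
    sum (λ k → - f k)      ≈⟨ sum-cong-≋ (λ k → -1*x≈-x (f k)) ⟨
    sum (λ k → - 1# * f k) ≈⟨ *-distribˡ-sum (- 1#) f ⟨
    - 1# * sum f           ≈⟨ -1*x≈-x (sum f) ⟩
    - sum f                ∎

  sum-splitAt : ∀ r {s} (f : Vector Carrier (r ℕ.+ s)) →
    sum f ≈ sum (f ∘ (_↑ˡ s)) + sum (f ∘ (r ↑ʳ_))
  sum-splitAt zero f = ≈-sym (+-identityˡ _)
  sum-splitAt (suc r) f = ≈-trans (+-congˡ (sum-splitAt r (f ∘ suc))) (≈-sym (+-assoc _ _ _))

  combination-cong : ∀ {r m} {a b : Vector Carrier r} (v : Fin r → Vector Carrier m) →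
    (∀ k → a k ≈ b k) → ∀ x → combination a v x ≈ combination b v x
  combination-cong v a≈b x = sum-cong-≋ (λ k → *-congʳ (a≈b k))

  combination-zeroˡ : ∀ {r m} (v : Fin r → Vector Carrier m) x → combination (λ _ → 0#) v x ≈ 0#
  combination-zeroˡ {r} v x = ≈-trans (sum-cong-≋ {r} (λ k → zeroˡ (v k x))) (sum-replicate-zero r)

  combination-zeroʳ : ∀ {r m} (a : Vector Carrier r) (x : Fin m) →
    combination a (λ _ _ → 0#) x ≈ 0#
  combination-zeroʳ {r} a x = ≈-trans (sum-cong-≋ {r} (λ k → zeroʳ (a k))) (sum-replicate-zero r)

  combination-sub : ∀ {r m} (a b : Vector Carrier r) (v : Fin r → Vector Carrier m) x →
    combination (λ k → a k - b k) v x ≈ combination a v x - combination b v x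
  combination-sub a b v x = begin
    sum (λ k → (a k - b k) * v k x)
      ≈⟨ sum-cong-≋ (λ k → [y-z]x≈yx-zx (v k x) (a k) (b k)) ⟩
    sum (λ k → a k * v k x - b k * v k x)
      ≈⟨ ∑-distrib-+ (λ k → a k * v k x) (λ k → - (b k * v k x)) ⟩
    combination a v x + sum (λ k → - (b k * v k x))
      ≈⟨ +-congˡ (sum-neg (λ k → b k * v k x)) ⟩
    combination a v x - combination b v x
      ∎

  combination-++ : ∀ {r s m} (a : Vector Carrier r) (b : Vector Carrier s)
    (v : Fin r → Vector Carrier m) (w : Fin s → Vector Carrier m) x →
    combination (a ++ b) (v ++ w) x ≈ combination a v x + combination b w x
  combination-++ {r} {s} a b v w x = begin
    combination (a ++ b) (v ++ w) x
      ≈⟨ sum-splitAt r _ ⟩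
    sum (λ k → (a ++ b) (k ↑ˡ s) * (v ++ w) (k ↑ˡ s) x)
      + sum (λ k → (a ++ b) (r ↑ʳ k) * (v ++ w) (r ↑ʳ k) x)
      ≡⟨ cong₂ _+_
           (sum-cong-≗ (λ k → cong₂ (λ α u → α * u x) (lookup-++ˡ a b k) (lookup-++ˡ v w k)))
           (sum-cong-≗ (λ k → cong₂ (λ α u → α * u x) (lookup-++ʳ a b k) (lookup-++ʳ v w k))) ⟩
    combination a v x + combination b w x
      ∎

  combination-compose : ∀ {r s m} {v : Fin r → Vector Carrier m} {w : Fin s → Vector Carrier m}
    (B : Fin r → Vector Carrier s) → (∀ k x → v k x ≈ combination (B k) w x) →
    ∀ a x → combination a v x ≈ combination (λ l → sum (λ k → a k * B k l)) w x
  combination-compose {r} {s} {v = v} {w} B v≈Bw a x = begin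
    sum (λ k → a k * v k x)
      ≈⟨ sum-cong-≋ {r} (λ k → *-congˡ (v≈Bw k x)) ⟩
    sum (λ k → a k * sum (λ l → B k l * w l x))
      ≈⟨ sum-cong-≋ {r} (λ k → *-distribˡ-sum (a k) (λ l → B k l * w l x)) ⟩
    sum (λ k → sum (λ l → a k * (B k l * w l x)))
      ≈⟨ ∑-comm (λ k l → a k * (B k l * w l x)) ⟩
    sum (λ l → sum (λ k → a k * (B k l * w l x)))
      ≈⟨ sum-cong-≋ {s} (λ l → sum-cong-≋ {r} (λ k → *-assoc (a k) (B k l) (w l x))) ⟨
    sum (λ l → sum (λ k → a k * B k l * w l x))
      ≈⟨ sum-cong-≋ {s} (λ l → *-distribʳ-sum (w l x) (λ k → a k * B k l)) ⟨
    sum (λ l → sum (λ k → a k * B k l) * w l x)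
      ∎

  combination-injective : ∀ {r m} {v : Fin r → Vector Carrier m} → LinearlyIndependent v →
    ∀ {a b} → (∀ x → combination a v x ≈ combination b v x) → ∀ k → a k ≈ b k
  combination-injective {v = v} independent {a} {b} a≈b k =
    x∙y⁻¹≈ε⇒x≈y (a k) (b k) (independent (λ k → a k - b k) difference-vanishes k)
    where
    difference-vanishes : ∀ x → combination (λ k → a k - b k) v x ≈ 0#
    difference-vanishes x = ≈-trans (combination-sub a b v x) (x≈y⇒x∙y⁻¹≈ε (a≈b x))

  relation⇒∈Span : ∀ {r m} {u : Vector Carrier m} {v : Fin r → Vector Carrier m} {α}
    (β : Vector Carrier r) → ¬ (α ≈ 0#) → (∀ x → α * u x + combination β v x ≈ 0#) → u ∈Span v
  relation⇒∈Span {u = u} {v} {α} β α≉0 relation = (λ k → - α⁻¹ * β k) , solved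
    where
    α⁻¹ : Carrier
    α⁻¹ = proj₁ (inverse α α≉0)

    solved : ∀ x → u x ≈ combination (λ k → - α⁻¹ * β k) v x
    solved x = begin
      u x                                 ≈⟨ *-identityˡ (u x) ⟨
      1# * u x                            ≈⟨ *-congʳ (proj₂ (inverse α α≉0)) ⟨
      α * α⁻¹ * u x                       ≈⟨ *-congʳ (*-comm α α⁻¹) ⟩
      α⁻¹ * α * u x                       ≈⟨ *-assoc α⁻¹ α (u x) ⟩
      α⁻¹ * (α * u x)                     ≈⟨ *-congˡ (+-inverseˡ-unique _ _ (relation x)) ⟩
      α⁻¹ * - combination β v x           ≈⟨ -‿distribʳ-* α⁻¹ _ ⟨
      - (α⁻¹ * combination β v x)         ≈⟨ -‿distribˡ-* α⁻¹ _ ⟩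
      - α⁻¹ * combination β v x           ≈⟨ *-distribˡ-sum (- α⁻¹) (λ k → β k * v k x) ⟩
      sum (λ k → - α⁻¹ * (β k * v k x))   ≈⟨ sum-cong-≋ (λ k → *-assoc (- α⁻¹) (β k) (v k x)) ⟨
      combination (λ k → - α⁻¹ * β k) v x ∎

  module _ (_≈?_ : Decidable _≈_) where

    independent-∷ : ∀ {r m} {u : Vector Carrier m} {v : Fin r → Vector Carrier m} →
      ¬ (u ∈Span v) → LinearlyIndependent v → LinearlyIndependent (u ∷ v)
    independent-∷ {u = u} {v} u∉span independent a vanishes = coefficient-vanishes
      where
      head-vanishes : a zero ≈ 0#
      head-vanishes with a zero ≈? 0#
      ... | yes a₀≈0 = a₀≈0
      ... | no a₀≉0 = ⊥-elim (u∉span (relation⇒∈Span (tail a) a₀≉0 vanishes))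

      tail-vanishes : ∀ x → combination (tail a) v x ≈ 0#
      tail-vanishes x = begin
        combination (tail a) v x                ≈⟨ +-identityˡ _ ⟨
        0# + combination (tail a) v x
          ≈⟨ +-congʳ (≈-trans (*-congʳ head-vanishes) (zeroˡ (u x))) ⟨
        a zero * u x + combination (tail a) v x ≈⟨ vanishes x ⟩
        0#                                      ∎

      coefficient-vanishes : ∀ k → a k ≈ 0#
      coefficient-vanishes zero = head-vanishes
      coefficient-vanishes (suc k) = independent (tail a) tail-vanishes k

  RankAtMost-zero : ∀ {m n r} {M : Matrix m n} → (∀ x y → M x y ≈ 0#) → RankAtMost M r
  RankAtMost-zero {r = r} M≈0 = (λ _ _ → 0#) , λ y → (λ _ → 0#) , λ x →
    ≈-trans (M≈0 x y) (≈-sym (combination-zeroʳ {r} _ x))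

  RankAtMost-zero⁻¹ : ∀ {m n} {M : Matrix m n} → RankAtMost M 0 → ∀ x y → M x y ≈ 0#
  RankAtMost-zero⁻¹ (_ , spans) x y = proj₂ (spans y) x

  RankAtMost-transpose : ∀ {m n r} {M : Matrix m n} →
    RankAtMost M r → RankAtMost (transpose M) r
  RankAtMost-transpose {n = n} {r} (w , spans) = rows , λ x → (λ k → w k x) , λ y →
    ≈-trans (proj₂ (spans y) x) (sum-cong-≋ {r} (λ k → *-comm _ _))
    where
    rows : Fin r → Vector Carrier n
    rows k y = proj₁ (spans y) k

  RankAtMost-+ : ∀ {m n r s} {A B C : Matrix m n} → RankAtMost A r → RankAtMost B s →
    (∀ x y → C x y ≈ A x y + B x y) → RankAtMost C (r ℕ.+ s)
  RankAtMost-+ {A = A} {B} {C} (v , A-spans) (w , B-spans) C≈A+B = v ++ w , spans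
    where
    spans : ∀ y → column C y ∈Span (v ++ w)
    spans y = a ++ b , λ x → begin
      C x y                                 ≈⟨ C≈A+B x y ⟩
      A x y + B x y                         ≈⟨ +-cong (proj₂ (A-spans y) x) (proj₂ (B-spans y) x) ⟩
      combination a v x + combination b w x ≈⟨ combination-++ a b v w x ⟨
      combination (a ++ b) (v ++ w) x       ∎
      where
      a = proj₁ (A-spans y)
      b = proj₁ (B-spans y)

  RankAtMost-pad : ∀ {m n r} s {M : Matrix m n} → RankAtMost M r → RankAtMost M (r ℕ.+ s)
  RankAtMost-pad s rank = RankAtMost-+ rank (RankAtMost-zero {M = λ _ _ → 0#} (λ _ _ → ≈-refl))
    (λ _ _ → ≈-sym (+-identityʳ _))

  RankAtMost-columnSupported : ∀ {m n} {M : Matrix m n} (Y : Fin n) →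
    (∀ x y → y ≢ Y → M x y ≈ 0#) → RankAtMost M 1
  RankAtMost-columnSupported {M = M} Y outside = (λ _ → column M Y) , spans
    where
    spans : ∀ y → column M y ∈Span (λ _ → column M Y)
    spans y with y ≟ Y
    ... | yes refl = (λ _ → 1#) , λ x → ≈-sym (≈-trans (+-identityʳ _) (*-identityˡ _))
    ... | no y≢Y = (λ _ → 0#) , λ x →
          ≈-trans (outside x y y≢Y) (≈-sym (combination-zeroˡ {1} (λ _ → column M Y) x))

  RankAtMost-rowSupported : ∀ {m n} {M : Matrix m n} (X : Fin m) →
    (∀ x y → x ≢ X → M x y ≈ 0#) → RankAtMost M 1
  RankAtMost-rowSupported {M = M} X outside =
    RankAtMost-transpose (RankAtMost-columnSupported {M = transpose M} X (λ y x → outside x y))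

  extendAlong : ∀ {d m} → (Fin d → Fin m) → Vector Carrier d → Vector Carrier m
  extendAlong g u x with any? (λ s → g s ≟ x)
  ... | yes (s , _) = u s
  ... | no _ = 0#

  record IsEmbedding {m n d e} (P : Matrix m n) (N : Matrix d e)
                     (g : Fin d → Fin m) (h : Fin e → Fin n) : Set (c ⊔ ℓ) where
    field
      on-grid     : ∀ s t → P (g s) (h t) ≈ N s t
      off-rows    : ∀ x y → (∀ s → g s ≢ x) → P x y ≈ 0#
      off-columns : ∀ x y → (∀ t → h t ≢ y) → P x y ≈ 0#

  RankAtMost-embedding : ∀ {m n d e r} {P : Matrix m n} {N : Matrix d e} {g h} →
    IsEmbedding P N g h → RankAtMost N r → RankAtMost P r
  RankAtMost-embedding {P = P} {g = g} {h} embedding (w , spans) = extendAlong g ∘ w , spans′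
    where
    open IsEmbedding embedding

    spans′ : ∀ y → column P y ∈Span (extendAlong g ∘ w)
    spans′ y with any? (λ t → h t ≟ y)
    ... | no ∉image = (λ _ → 0#) , λ x →
          ≈-trans (off-columns x y (λ t ht≡y → ∉image (t , ht≡y)))
                  (≈-sym (combination-zeroˡ (extendAlong g ∘ w) x))
    ... | yes (t , refl) = b , entries
      where
      b = proj₁ (spans t)

      -- Deciding whether x lies in the image of g also evaluates extendAlong in the goal.
      entries : ∀ x → P x (h t) ≈ combination b (extendAlong g ∘ w) x
      entries x with any? (λ s → g s ≟ x)
      ... | yes (s , refl) = ≈-trans (on-grid s t) (proj₂ (spans t) s)
      ... | no ∉image = ≈-trans (off-rows x (h t) (λ s gs≡x → ∉image (s , gs≡x)))
                                (≈-sym (combination-zeroʳ b x))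

  record IsExtensionByZero {m₁ n₁ m n} (F : Diagram m₁ n₁) (ψ : Cell m₁ n₁ → Cell m n)
                           (M : Matrix m₁ n₁) (P : Matrix m n) : Set (c ⊔ ℓ) where
    field
      at-image  : ∀ i j x y → (i , j) ∈D F → ψ (i , j) ≡ (x , y) → P x y ≈ M i j
      off-image : ∀ x y → (∀ i j → (i , j) ∈D F → ψ (i , j) ≢ (x , y)) → P x y ≈ 0#

  extendByZero : ∀ {m₁ n₁ m n} → Diagram m₁ n₁ → (Cell m₁ n₁ → Cell m n) →
    Matrix m₁ n₁ → Matrix m n
  extendByZero F ψ M x y with preimage? F ψ x y
  ... | yes (i , j , _) = M i j
  ... | no _ = 0#

  extendByZero-isExtension : ∀ {m₁ n₁ m n} {F : Diagram m₁ n₁} {ψ : Cell m₁ n₁ → Cell m n} {M} →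
    InjectiveOn F ψ → IsExtensionByZero F ψ M (extendByZero F ψ M)
  extendByZero-isExtension {F = F} {ψ} {M} injective =
    record { at-image = at-image ; off-image = off-image }
    where
    at-image : ∀ i j x y → (i , j) ∈D F → ψ (i , j) ≡ (x , y) →
      extendByZero F ψ M x y ≈ M i j
    at-image i j x y c hit with preimage? F ψ x y
    ... | no ∉preimage = contradiction (i , j , c , hit) ∉preimage
    ... | yes (i′ , j′ , c′ , hit′) with injective (i′ , j′) (i , j) c′ c (trans hit′ (sym hit))
    ...   | refl = ≈-refl

    off-image : ∀ x y → (∀ i j → (i , j) ∈D F → ψ (i , j) ≢ (x , y)) →
      extendByZero F ψ M x y ≈ 0#
    off-image x y missed with preimage? F ψ x y
    ... | yes (i , j , c , hit) = contradiction hit (missed i j c)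
    ... | no _ = ≈-refl

  IsExtensionByZero-transpose :
    ∀ {m₁ n₁ m n} {F : Diagram m₁ n₁} {ψ : Cell m₁ n₁ → Cell m n} {M P} →
    IsExtensionByZero F ψ M P → IsExtensionByZero (transpose F) (ψ ∘ swap) (transpose M) P
  IsExtensionByZero-transpose extension = record
    { at-image = λ j i → at-image i j
    ; off-image = λ x y missed → off-image x y (λ i j → missed j i)
    }
    where open IsExtensionByZero extension

  extension-of-zero : ∀ {m₁ n₁ m n} {F : Diagram m₁ n₁} {ψ : Cell m₁ n₁ → Cell m n} {M P} →
    IsExtensionByZero F ψ M P → (∀ i j → M i j ≈ 0#) → ∀ x y → P x y ≈ 0#
  extension-of-zero {F = F} {ψ} extension M≈0 x y with preimage? F ψ x y
  ... | yes (i , j , c , hit) = ≈-trans (IsExtensionByZero.at-image extension i j x y c hit) (M≈0 i j)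
  ... | no ∉preimage =
        IsExtensionByZero.off-image extension x y (λ i j c hit → ∉preimage (i , j , c , hit))

  product-isEmbedding : ∀ {m₁ n₁ m n} {F : Diagram m₁ n₁} {ψ : Cell m₁ n₁ → Cell m n} {M P} →
    IsExtensionByZero F ψ M P → (∀ i j → F i j ≡ false → M i j ≈ 0#) →
    ∀ {ρ κ} → Injective _≡_ _≡_ ρ → Injective _≡_ _≡_ κ →
    (∀ i j → (i , j) ∈D F → ψ (i , j) ≡ (ρ i , κ j)) → IsEmbedding P M ρ κ
  product-isEmbedding {F = F} {ψ} {M} {P} extension zero-off {ρ} {κ} ρ-injective κ-injective form =
    record { on-grid = on-grid ; off-rows = off-rows ; off-columns = off-columns }
    where
    open IsExtensionByZero extension

    on-grid : ∀ s t → P (ρ s) (κ t) ≈ M s t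
    on-grid s t with F s t in st
    ... | true = at-image s t _ _ st (form s t st)
    ... | false = ≈-trans (off-image _ _ missed) (≈-sym (zero-off s t st))
      where
      missed : ∀ i j → (i , j) ∈D F → ψ (i , j) ≢ (ρ s , κ t)
      missed i j c hit with ×-≡,≡←≡ (trans (sym (form i j c)) hit)
      ... | ρi≡ρs , κj≡κt with ρ-injective ρi≡ρs | κ-injective κj≡κt
      ...   | refl | refl with trans (sym c) st
      ...     | ()

    off-rows : ∀ x y → (∀ s → ρ s ≢ x) → P x y ≈ 0#
    off-rows x y ∉rows = off-image x y (λ i j c hit →
      ∉rows i (trans (cong proj₁ (sym (form i j c))) (cong proj₁ hit)))

    off-columns : ∀ x y → (∀ t → κ t ≢ y) → P x y ≈ 0#
    off-columns x y ∉columns = off-image x y (λ i j c hit →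
      ∉columns j (trans (cong proj₂ (sym (form i j c))) (cong proj₂ hit)))

  RankAtMost-extension :
    ∀ {m₁ n₁ m n r} {F : Diagram m₁ n₁} {ψ : Cell m₁ n₁ → Cell m n} {M P} →
    IsFerrers F → InjectiveOn F ψ → PreservesLines F ψ → (∀ i j → F i j ≡ false → M i j ≈ 0#) →
    IsExtensionByZero F ψ M P → RankAtMost M r → RankAtMost P r
  RankAtMost-extension {zero} _ _ _ _ extension _ =
    RankAtMost-zero (λ x y → IsExtensionByZero.off-image extension x y (λ ()))
  RankAtMost-extension {suc _} {zero} _ _ _ _ extension _ =
    RankAtMost-zero (λ x y → IsExtensionByZero.off-image extension x y (λ _ ()))
  RankAtMost-extension {suc _} {suc _} {r = zero} _ _ _ _ extension rank =
    RankAtMost-zero (extension-of-zero extension (RankAtMost-zero⁻¹ rank))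
  RankAtMost-extension {suc _} {suc _} {r = suc r} ferrers injective lines zero-off extension rank
    with shape ferrers injective lines
  ... | product ρ κ ρ-injective κ-injective form =
        RankAtMost-embedding (product-isEmbedding extension zero-off ρ-injective κ-injective form) rank
  ... | transposed ρ κ ρ-injective κ-injective form =
        RankAtMost-embedding
          (product-isEmbedding (IsExtensionByZero-transpose extension) (λ j i → zero-off i j)
             κ-injective ρ-injective (λ j i → form i j))
          (RankAtMost-transpose rank)
  ... | inRow X form = RankAtMost-pad r (RankAtMost-rowSupported X (λ x y x≢X →
          IsExtensionByZero.off-image extension x y (λ i j c hit →
            x≢X (trans (sym (cong proj₁ hit)) (form i j c)))))
  ... | inColumn Y form = RankAtMost-pad r (RankAtMost-columnSupported Y (λ x y y≢Y →
          IsExtensionByZero.off-image extension x y (λ i j c hit →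
            y≢Y (trans (sym (cong proj₂ hit)) (form i j c)))))

  sum-of-disjoint-extensions :
    ∀ {m₁ n₁ m₂ n₂ m n} {F₁ : Diagram m₁ n₁} {F₂ : Diagram m₂ n₂}
      {φ₁ : Cell m₁ n₁ → Cell m n} {φ₂ : Cell m₂ n₂ → Cell m n}
      {M₁ : Matrix m₁ n₁} {M₂ : Matrix m₂ n₂} {P₁ P₂ M : Matrix m n} →
    (∀ x y → x ∈D F₁ → y ∈D F₂ → φ₁ x ≢ φ₂ y) →
    IsExtensionByZero F₁ φ₁ M₁ P₁ → IsExtensionByZero F₂ φ₂ M₂ P₂ →
    (∀ i j x y → (i , j) ∈D F₁ → φ₁ (i , j) ≡ (x , y) → M x y ≈ M₁ i j) →
    (∀ i j x y → (i , j) ∈D F₂ → φ₂ (i , j) ≡ (x , y) → M x y ≈ M₂ i j) →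
    (∀ x y → (∀ i j → (i , j) ∈D F₁ → φ₁ (i , j) ≢ (x , y)) →
             (∀ i j → (i , j) ∈D F₂ → φ₂ (i , j) ≢ (x , y)) → M x y ≈ 0#) →
    ∀ x y → M x y ≈ P₁ x y + P₂ x y
  sum-of-disjoint-extensions {F₁ = F₁} {F₂} {φ₁} {φ₂} {M₁} {M₂} {P₁} {P₂} {M}
    disjoint extension₁ extension₂ at₁ at₂ elsewhere x y =
    split (preimage? F₁ φ₁ x y) (preimage? F₂ φ₂ x y)
    where
    module E₁ = IsExtensionByZero extension₁
    module E₂ = IsExtensionByZero extension₂

    split : Dec (Preimage F₁ φ₁ x y) → Dec (Preimage F₂ φ₂ x y) → M x y ≈ P₁ x y + P₂ x y
    split (yes (i , j , c , hit)) _ = begin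
      M x y           ≈⟨ at₁ i j x y c hit ⟩
      M₁ i j          ≈⟨ E₁.at-image i j x y c hit ⟨
      P₁ x y          ≈⟨ +-identityʳ _ ⟨
      P₁ x y + 0#     ≈⟨ +-congˡ (E₂.off-image x y missed₂) ⟨
      P₁ x y + P₂ x y ∎
      where
      missed₂ : ∀ i′ j′ → (i′ , j′) ∈D F₂ → φ₂ (i′ , j′) ≢ (x , y)
      missed₂ i′ j′ c′ hit′ = disjoint _ _ c c′ (trans hit (sym hit′))
    split (no ∉₁) (yes (i , j , c , hit)) = begin
      M x y           ≈⟨ at₂ i j x y c hit ⟩
      M₂ i j          ≈⟨ E₂.at-image i j x y c hit ⟨
      P₂ x y          ≈⟨ +-identityˡ _ ⟨
      0# + P₂ x y     ≈⟨ +-congʳ (E₁.off-image x y (λ i j c hit → ∉₁ (i , j , c , hit))) ⟨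
      P₁ x y + P₂ x y ∎
    split (no ∉₁) (no ∉₂) = begin
      M x y           ≈⟨ elsewhere x y missed₁ missed₂ ⟩
      0#              ≈⟨ +-identityʳ 0# ⟨
      0# + 0#         ≈⟨ +-cong (E₁.off-image x y missed₁) (E₂.off-image x y missed₂) ⟨
      P₁ x y + P₂ x y ∎
      where
      missed₁ : ∀ i j → (i , j) ∈D F₁ → φ₁ (i , j) ≢ (x , y)
      missed₁ i j c hit = ∉₁ (i , j , c , hit)
      missed₂ : ∀ i j → (i , j) ∈D F₂ → φ₂ (i , j) ≢ (x , y)
      missed₂ i j c hit = ∉₂ (i , j , c , hit)

module FiniteField {c ℓ} (K : Field c ℓ) {q : ℕ} (cardinality : HasCardinality K q) where

  open Field K hiding (zero) renaming (refl to ≈-refl; sym to ≈-sym; trans to ≈-trans)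
  open LinAlg K using (Matrix; IndependentCols; IsRank)
  open LinearAlgebra K
  open import Algebra.Properties.Semiring.Sum semiring using (sum)
  open import Relation.Binary.Reasoning.Setoid setoid

  private
    enum : Fin q → Carrier
    enum = proj₁ cardinality

    enum-injective : ∀ i j → enum i ≈ enum j → i ≡ j
    enum-injective = proj₁ (proj₂ cardinality)

    code : Carrier → Fin q
    code x = proj₁ (proj₂ (proj₂ cardinality) x)

    enum-code : ∀ x → enum (code x) ≈ x
    enum-code x = proj₂ (proj₂ (proj₂ cardinality) x)

    code-injective : ∀ {x y} → code x ≡ code y → x ≈ y
    code-injective {x} {y} same =
      ≈-trans (≈-sym (enum-code x)) (≈-trans (reflexive (cong enum same)) (enum-code y))

  infix 4 _≈?_
  _≈?_ : Decidable _≈_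
  x ≈? y = map′ code-injective
    (λ x≈y → enum-injective _ _ (≈-trans (enum-code x) (≈-trans x≈y (≈-sym (enum-code y)))))
    (code x ≟ code y)

  1<q : 1 < q
  1<q = ≢⇒1< (0≉1 ∘ code-injective)

  ∃-vector? : ∀ r {p} {P : Vector Carrier r → Set p} →
    (∀ {a b} → (∀ k → a k ≈ b k) → P a → P b) → (∀ a → Dec (P a)) → Dec (∃ P)
  ∃-vector? zero resp P? = map′ ([] ,_) (λ (a , Pa) → resp {a} {[]} (λ ()) Pa) (P? [])
  ∃-vector? (suc r) {P = P} resp P? =
    map′ extend restrict (any? (λ i → ∃-vector? r (respects-tail i) (λ a → P? (enum i ∷ a))))
    where
    respects-tail : ∀ i {a b} → (∀ k → a k ≈ b k) → P (enum i ∷ a) → P (enum i ∷ b)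
    respects-tail i a≈b = resp (λ { zero → ≈-refl ; (suc k) → a≈b k })

    extend : (∃ λ i → ∃ λ a → P (enum i ∷ a)) → ∃ P
    extend (i , a , Pa) = enum i ∷ a , Pa

    restrict : ∃ P → ∃ λ i → ∃ λ a → P (enum i ∷ a)
    restrict (a , Pa) = code (a zero) , tail a , resp encoded Pa
      where
      encoded : ∀ k → a k ≈ (enum (code (a zero)) ∷ tail a) k
      encoded zero = ≈-sym (enum-code (a zero))
      encoded (suc k) = ≈-refl

  infix 4 _∈Span?_
  _∈Span?_ : ∀ {s m} (u : Vector Carrier m) (w : Fin s → Vector Carrier m) → Dec (u ∈Span w)
  u ∈Span? w = ∃-vector? _ (λ a≈b u≈a x → ≈-trans (u≈a x) (combination-cong w a≈b x))
    (λ b → all? (λ x → u x ≈? combination b w x))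

  IsRank⇒RankAtMost : ∀ {m n r} {M : Matrix m n} → IsRank M r → RankAtMost M r
  IsRank⇒RankAtMost {r = r} {M} ((σ , independent) , maximal) = column M ∘ σ , spans
    where
    spans : ∀ j → column M j ∈Span (column M ∘ σ)
    spans j with column M j ∈Span? (column M ∘ σ)
    ... | yes j∈span = j∈span
    ... | no j∉span = contradiction (maximal (suc r) (j ∷ σ) enlarged) 1+n≰n
      where
      enlarged : IndependentCols M (j ∷ σ)
      enlarged = linearlyIndependent⇒independentCols M (j ∷ σ)
        (independent-∷ _≈?_ j∉span (independentCols⇒linearlyIndependent M σ independent))

  independent-in-span⇒≤ :
    ∀ {r s m} {v : Fin r → Vector Carrier m} {w : Fin s → Vector Carrier m} →
    LinearlyIndependent v → (∀ k → v k ∈Span w) → r ≤ s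
  independent-in-span⇒≤ {r} {s} {v = v} {w} independent spans =
    power-injection⇒≤ 1<q coded-coordinates coded-coordinates-injective
    where
    B : Fin r → Vector Carrier s
    B k = proj₁ (spans k)

    coordinates : Vector Carrier r → Vector Carrier s
    coordinates a l = sum (λ k → a k * B k l)

    coded-coordinates : (Fin r → Fin q) → Fin s → Fin q
    coded-coordinates f = code ∘ coordinates (enum ∘ f)

    coded-coordinates-injective : ∀ f g → coded-coordinates f ≗ coded-coordinates g → f ≗ g
    coded-coordinates-injective f g same k =
      enum-injective _ _ (combination-injective independent same-combination k)
      where
      same-combination : ∀ x → combination (enum ∘ f) v x ≈ combination (enum ∘ g) v x
      same-combination x = begin
        combination (enum ∘ f) v x
          ≈⟨ combination-compose B (λ k → proj₂ (spans k)) (enum ∘ f) x ⟩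
        combination (coordinates (enum ∘ f)) w x
          ≈⟨ combination-cong w (λ l → code-injective (same l)) x ⟩
        combination (coordinates (enum ∘ g)) w x
          ≈⟨ combination-compose B (λ k → proj₂ (spans k)) (enum ∘ g) x ⟨
        combination (enum ∘ g) v x
          ∎

  IsRank-≤ : ∀ {m n r s} {M : Matrix m n} → IsRank M r → RankAtMost M s → r ≤ s
  IsRank-≤ {M = M} ((σ , independent) , _) (_ , spans) =
    independent-in-span⇒≤ (independentCols⇒linearlyIndependent M σ independent) (spans ∘ σ)

  RankAtMost-extendByZero :
    ∀ {m₁ n₁ m n r} {F : Diagram m₁ n₁} {F′ : Diagram m n} {φ : Cell m₁ n₁ → Cell m n}
      {M : Matrix m₁ n₁} → IsFerrers F → ProperMap F F′ φ → (∀ i j → F i j ≡ false → M i j ≈ 0#) →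
    IsRank M r → RankAtMost (extendByZero F φ M) r
  RankAtMost-extendByZero ferrers proper zero-off rank =
    RankAtMost-extension ferrers (ProperMap.injective proper) (ProperMap.lines proper) zero-off
      (extendByZero-isExtension (ProperMap.injective proper)) (IsRank⇒RankAtMost rank)

open import Data.Nat using (_+_)

lemma4p3 : ∀ {c ℓ} (q : ℕ) → IsPrimePower q →
    (K : Field c ℓ) → HasCardinality K q →
    ∀ {m₁ n₁ m₂ n₂ m n}
      (F₁ : Diagram m₁ n₁) (F₂ : Diagram m₂ n₂) (F : Diagram m n) →
      IsFerrers F₁ → IsFerrers F₂ → IsFerrers F →
      (M₁ : LinAlg.Matrix K m₁ n₁) (M₂ : LinAlg.Matrix K m₂ n₂) →
      (∀ i j → F₁ i j ≡ false → Field._≈_ K (M₁ i j) (Field.0# K)) →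
      (∀ i j → F₂ i j ≡ false → Field._≈_ K (M₂ i j) (Field.0# K)) →
      (φ₁ : Cell m₁ n₁ → Cell m n) (φ₂ : Cell m₂ n₂ → Cell m n) →
      ProperCombination F₁ F₂ F φ₁ φ₂ →
      (M₁₂ : LinAlg.Matrix K m n) →
      (∀ i₁ j₁ i j → (i₁ , j₁) ∈D F₁ → φ₁ (i₁ , j₁) ≡ (i , j) →
         Field._≈_ K (M₁₂ i j) (M₁ i₁ j₁)) →
      (∀ i₂ j₂ i j → (i₂ , j₂) ∈D F₂ → φ₂ (i₂ , j₂) ≡ (i , j) →
         Field._≈_ K (M₁₂ i j) (M₂ i₂ j₂)) →
      (∀ i j →
         (∀ i₁ j₁ → (i₁ , j₁) ∈D F₁ → ¬ (φ₁ (i₁ , j₁) ≡ (i , j))) →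
         (∀ i₂ j₂ → (i₂ , j₂) ∈D F₂ → ¬ (φ₂ (i₂ , j₂) ≡ (i , j))) →
         Field._≈_ K (M₁₂ i j) (Field.0# K)) →
      ∀ r r₁ r₂ →
      LinAlg.IsRank K M₁₂ r → LinAlg.IsRank K M₁ r₁ → LinAlg.IsRank K M₂ r₂ →
      r ≤ r₁ + r₂
lemma4p3 _ _ K cardinality _ _ _ ferrers₁ ferrers₂ _ _ _ zero-off₁ zero-off₂ _ _ proper
         _ at₁ at₂ elsewhere _ _ _ rank rank₁ rank₂ =
  IsRank-≤ rank (RankAtMost-+ (RankAtMost-extendByZero ferrers₁ map₁ zero-off₁ rank₁)
                              (RankAtMost-extendByZero ferrers₂ map₂ zero-off₂ rank₂)
                              (sum-of-disjoint-extensions disjoint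
                                 (extendByZero-isExtension (ProperMap.injective map₁))
                                 (extendByZero-isExtension (ProperMap.injective map₂))
                                 at₁ at₂ elsewhere))
  where
  open LinearAlgebra K
  open FiniteField K cardinality
  open ProperCombination proper
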